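{- Let $n\ge1$ and $0\le m\le\binom{n}{2}$, and let $L(n,m)$ be the lex graph. Then the intervals $[A\setminus Int(A);A\cup Ext(A)]$, $A$ ranging over the maximal independent sets of $L(n,m)$, form a partition of $2^{[n]}$.
   Context: For finite $A,B\subset\mathbb{N}$, $A$ precedes $B$ in lexicographic order if $\min(A\triangle B)\in A$. The lex graph $L(n,m)$ has vertex set $[n]=\{1,\ldots,n\}$ and edge set the first $m$ elements of $\binom{[n]}{2}$ in lexicographic order (i.e. $\{1,2\},\{1,3\},\ldots,\{1,n\},\{2,3\},\{2,4\},\ldots$). Labels give the linear order on vertices. For an independent set $A$: $Ext(A)=\{u\notin A:\ \exists a\in A,\ a\in N(u),\ u>a\}$; for $u\in A$, $Subs(u)=\{w\in N(u): (A\setminus\{u\})\cup\{w\}\text{ independent}\}$, $u$ is internally active if $Subs(u)=\emptyset$ or $u>\max Subs(u)$; $Int(A)$ is the set of internally active vertices of $A$. $[X;Y]=\{Z: X\subseteq Z\subseteq Y\}$. A family of intervals forms a partition if the intervals (for distinct maximal independent sets) are pairwise disjoint and their union is the whole power set. -}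

module Defs where

open import Data.Nat using (ℕ; zero; suc)
open import Data.Fin using (Fin; toℕ; _<_)
open import Data.Fin.Subset using (Subset; _∈_; _∉_)
open import Data.List using (List; []; _∷_; take; concatMap; filter; allFin)
open import Data.List.Membership.Propositional using () renaming (_∈_ to _∈ₗ_)
open import Data.Product using (_×_; _,_; ∃; ∃-syntax)
open import Data.Sum using (_⊎_)
open import Data.Fin.Properties using (_<?_)
open import Relation.Nullary using (¬_; does)
open import Data.Vec using (tabulate; lookup)
open import Data.Bool using (true; false; if_then_else_)
open import Data.Fin using (_≟_)
open import Relation.Binary.PropositionalEquality using (_≡_)

-- Vertices of L(n,m) are Fin n; vertex i carries label toℕ i + 1, so the
-- linear order on vertices is the order _<_ on Fin n.

-- All 2-subsets {i,j} (i < j) of the vertex set, listed in lexicographic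
-- order: {0,1},{0,2},...,{0,n-1},{1,2},...
pairsLex : (n : ℕ) → List (Fin n × Fin n)
pairsLex n = concatMap (λ i → Data.List.map (λ j → (i , j)) (filter (λ j → i <? j) (allFin n))) (allFin n)

Edge : (n m : ℕ) → Fin n → Fin n → Set
Edge n m u v = ((u , v) ∈ₗ take m (pairsLex n)) ⊎ ((v , u) ∈ₗ take m (pairsLex n))

swapIn : {n : ℕ} → Subset n → Fin n → Fin n → Subset n
swapIn A u w = tabulate (λ x → if does (x ≟ w) then true else (if does (x ≟ u) then false else lookup A x))

module LexGraph (n m : ℕ) where

  E : Fin n → Fin n → Set
  E = Edge n m

  Independent : Subset n → Set
  Independent A = ∀ u v → u ∈ A → v ∈ A → ¬ E u v

  MaximalIndependent : Subset n → Set
  MaximalIndependent A = Independent A × (∀ u → u ∉ A → ∃[ a ] (a ∈ A × E u a))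

  Ext : Subset n → Fin n → Set
  Ext A u = u ∉ A × ∃[ a ] (a ∈ A × E a u × a < u)

  Subs : Subset n → Fin n → Fin n → Set
  Subs A u w = E u w × Independent (swapIn A u w)

  -- u ∈ Int(A): u ∈ A and Subs(u) = ∅ or u > max Subs(u)
  Int : Subset n → Fin n → Set
  Int A u = u ∈ A × (∀ w → Subs A u w → w < u)

  InInterval : Subset n → Subset n → Set
  InInterval A Z = (∀ x → x ∈ A → ¬ Int A x → x ∈ Z)
                 × (∀ z → z ∈ Z → z ∈ A ⊎ Ext A z)

-- An initial segment of the lexicographic order on pairs consists of the
-- complete rows {a, b} with a < k followed by {k, k+1}, …, {k, k+r}. So in
-- L(n, m) the vertices below the pivot k are universal, the pivot is moreover
-- adjacent to k+1, …, k+r, and no other edges exist. The maximal independent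
-- sets are therefore the singletons {i} with i < k, the pivot together with
-- the vertices beyond k + r, and (when r > 0) all vertices above the pivot.
-- Their intervals consist, respectively, of the sets Z with minimum i, the
-- sets of vertices ≥ k containing the pivot when r > 0, and the sets of
-- vertices > k; these classes partition the power set.

module Submission where

open import Defs
open import Data.Bool using (true; false)
open import Data.Empty using (⊥-elim)
open import Data.Fin as Fin using (Fin; zero; suc; toℕ; fromℕ<; _≟_)
open import Data.Fin.Properties using (_<?_; toℕ-injective; toℕ-fromℕ<; any?)
open import Data.Fin.Subset using (Subset; _∈_; _∉_; _⊆_; ⁅_⁆; inside; outside)
open import Data.Fin.Subset.Properties using (_∈?_; ⊆-antisym; x∈⁅x⁆; x∈⁅y⁆⇒x≡y)
open import Data.List using (List; []; _∷_; map; _++_; length; take; filter; allFin; concatMap)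
open import Data.List.Properties using (map-∘; map-tabulate; concatMap-map; map-concatMap; concatMap-cong; take-map; take-all; length-map; length-tabulate)
open import Data.List.Membership.Propositional using () renaming (_∈_ to _∈ₗ_)
open import Data.List.Membership.Propositional.Properties using (∈-map⁺; ∈-map⁻; ∈-++⁺ˡ; ∈-++⁺ʳ; ∈-++⁻; ∈-allFin)
open import Data.List.Relation.Unary.Any using () renaming (here to hereₗ; there to thereₗ)
open import Data.Nat as ℕ using (ℕ; zero; suc; _+_; _∸_; _≤_; _<_; _≥_; z≤n; s≤s; _≤?_)
open import Data.Nat.Combinatorics using (_C_)
open import Data.Nat.Properties using (≤-refl; ≤-reflexive; ≤-trans; <-trans; ≤-<-trans; <-≤-trans; <-irrefl; <-asym; <-cmp; ≮⇒≥; ≰⇒>; ≤∧≢⇒<; <⇒≤; <⇒≱; <⇒≢; ≤-antisym; m≤m+n; m<m+n; m≤n⇒m<n∨m≡n; +-cancelˡ-<; +-identityʳ; n≢0⇒n>0)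
open import Data.Product using (_×_; _,_; ∃-syntax; Σ-syntax)
open import Data.Sum as Sum using (_⊎_; inj₁; inj₂)
open import Data.Vec using (_∷_; tabulate; here; there)
open import Data.Vec.Properties using (lookup∘tabulate; lookup⇒[]=; []=⇒lookup)
open import Function using (_∘_; id)
open import Relation.Binary using (tri<; tri≈; tri>)
open import Relation.Binary.PropositionalEquality
open import Relation.Nullary using (¬_; yes; no; does)
open import Relation.Nullary.Decidable using (dec-true; _×-dec_; _⊎-dec_)
open import Relation.Unary using (Pred; Decidable)

-- Initial segments of the lexicographic order

LexPrefix : ℕ → ℕ → ℕ → ℕ → Set
LexPrefix k r a b = a < b × (a < k ⊎ (a ≡ k × b ≤ k + r))

record LexShape (n m : ℕ) : Set where
  field
    k r     : ℕ
    k+r<n   : k + r < n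
    prefix⇒ : ∀ {u v} → (u , v) ∈ₗ take m (pairsLex n) → LexPrefix k r (toℕ u) (toℕ v)
    prefix⇐ : ∀ {u v} → LexPrefix k r (toℕ u) (toℕ v) → (u , v) ∈ₗ take m (pairsLex n)

shift : ∀ {n} → Fin n × Fin n → Fin (suc n) × Fin (suc n)
shift (a , b) = suc a , suc b

firstRow : ∀ n → List (Fin (suc n) × Fin (suc n))
firstRow n = map (λ j → zero , suc j) (allFin n)

row : ∀ {n} → Fin n → List (Fin n × Fin n)
row {n} i = map (i ,_) (filter (i <?_) (allFin n))

allFin-suc : ∀ n → allFin (suc n) ≡ zero ∷ map suc (allFin n)
allFin-suc n = cong (zero ∷_) (sym (map-tabulate id suc))

filter-zero<?-map-suc : ∀ {n} (xs : List (Fin n)) → filter (zero {n} <?_) (map suc xs) ≡ map suc xs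
filter-zero<?-map-suc []       = refl
filter-zero<?-map-suc (x ∷ xs) = cong (suc x ∷_) (filter-zero<?-map-suc xs)

filter-suc<?-map-suc : ∀ {n} (i : Fin n) (xs : List (Fin n)) →
                       filter (suc i <?_) (map suc xs) ≡ map suc (filter (i <?_) xs)
filter-suc<?-map-suc i [] = refl
-- Both suc i <? suc x and i <? x reduce to this test.
filter-suc<?-map-suc i (x ∷ xs) with toℕ i ℕ.<ᵇ toℕ x
... | true  = cong (suc x ∷_) (filter-suc<?-map-suc i xs)
... | false = filter-suc<?-map-suc i xs

row-zero : ∀ n → row {suc n} zero ≡ firstRow n
row-zero n = begin
  map (zero ,_) (filter (zero {n} <?_) (allFin (suc n)))     ≡⟨ cong (map (zero ,_) ∘ filter (zero {n} <?_)) (allFin-suc n) ⟩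
  map (zero ,_) (filter (zero {n} <?_) (map suc (allFin n)))  ≡⟨ cong (map (zero ,_)) (filter-zero<?-map-suc (allFin n)) ⟩
  map (zero ,_) (map suc (allFin n))                          ≡⟨ map-∘ (allFin n) ⟨
  firstRow n                                                  ∎
  where open ≡-Reasoning

row-suc : ∀ {n} (i : Fin n) → row (suc i) ≡ map shift (row i)
row-suc {n} i = begin
  map (suc i ,_) (filter (suc i <?_) (allFin (suc n)))      ≡⟨ cong (map (suc i ,_) ∘ filter (suc i <?_)) (allFin-suc n) ⟩
  map (suc i ,_) (filter (suc i <?_) (map suc (allFin n)))  ≡⟨ cong (map (suc i ,_)) (filter-suc<?-map-suc i (allFin n)) ⟩
  map (suc i ,_) (map suc (filter (i <?_) (allFin n)))      ≡⟨ map-∘ (filter (i <?_) (allFin n)) ⟨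
  map (shift ∘ (i ,_)) (filter (i <?_) (allFin n))          ≡⟨ map-∘ (filter (i <?_) (allFin n)) ⟩
  map shift (row i)                                         ∎
  where open ≡-Reasoning

pairsLex-suc : ∀ n → pairsLex (suc n) ≡ firstRow n ++ map shift (pairsLex n)
pairsLex-suc n = begin
  concatMap row (allFin (suc n))                        ≡⟨ cong (concatMap row) (allFin-suc n) ⟩
  row zero ++ concatMap row (map suc (allFin n))        ≡⟨ cong₂ _++_ (row-zero n) (concatMap-map row suc (allFin n)) ⟩
  firstRow n ++ concatMap (row ∘ suc) (allFin n)        ≡⟨ cong (firstRow n ++_) (concatMap-cong row-suc (allFin n)) ⟩
  firstRow n ++ concatMap (map shift ∘ row) (allFin n)  ≡⟨ cong (firstRow n ++_) (map-concatMap shift row (allFin n)) ⟨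
  firstRow n ++ map shift (pairsLex n)                  ∎
  where open ≡-Reasoning

take-++ˡ : ∀ {A : Set} m (xs ys : List A) → m ≤ length xs → take m (xs ++ ys) ≡ take m xs
take-++ˡ zero    xs       ys _         = refl
take-++ˡ (suc m) (x ∷ xs) ys (s≤s m≤) = cong (x ∷_) (take-++ˡ m xs ys m≤)

take-++ʳ : ∀ {A : Set} m (xs ys : List A) → length xs ≤ m →
           take m (xs ++ ys) ≡ xs ++ take (m ∸ length xs) ys
take-++ʳ m       []       ys _         = refl
take-++ʳ (suc m) (x ∷ xs) ys (s≤s ≤m) = cong (x ∷_) (take-++ʳ m xs ys ≤m)

take-tabulate-suc : ∀ n m → take m (Data.List.tabulate {n = n} Fin.suc) ≡ map Fin.suc (take m (allFin n))
take-tabulate-suc n m = trans (cong (take m) (sym (map-tabulate id Fin.suc))) (take-map m (allFin n))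

∈-take-allFin⁻ : ∀ {n m} {x : Fin n} → x ∈ₗ take m (allFin n) → toℕ x < m
∈-take-allFin⁻ {suc n} {suc m} {zero}  _         = s≤s z≤n
∈-take-allFin⁻ {suc n} {suc m} {suc x} (thereₗ p) with ∈-map⁻ Fin.suc (subst (suc x ∈ₗ_) (take-tabulate-suc n m) p)
... | y , y∈ , refl = s≤s (∈-take-allFin⁻ y∈)

∈-take-allFin⁺ : ∀ {n m} {x : Fin n} → toℕ x < m → x ∈ₗ take m (allFin n)
∈-take-allFin⁺ {suc n} {suc m} {zero}  _       = hereₗ refl
∈-take-allFin⁺ {suc n} {suc m} {suc x} (s≤s x<m) =
  thereₗ (subst (suc x ∈ₗ_) (sym (take-tabulate-suc n m)) (∈-map⁺ Fin.suc (∈-take-allFin⁺ x<m)))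

length-firstRow : ∀ n → length (firstRow n) ≡ n
length-firstRow n = trans (length-map _ (allFin n)) (length-tabulate id)

prefix-suc⁺ : ∀ {k r a b} → LexPrefix k r a b → LexPrefix (suc k) r (suc a) (suc b)
prefix-suc⁺ (a<b , inj₁ a<k)             = s≤s a<b , inj₁ (s≤s a<k)
prefix-suc⁺ (a<b , inj₂ (refl , b≤k+r)) = s≤s a<b , inj₂ (refl , s≤s b≤k+r)

prefix-suc⁻ : ∀ {k r a b} → LexPrefix (suc k) r (suc a) (suc b) → LexPrefix k r a b
prefix-suc⁻ (s≤s a<b , inj₁ (s≤s a<k))             = a<b , inj₁ a<k
prefix-suc⁻ (s≤s a<b , inj₂ (refl , s≤s b≤k+r)) = a<b , inj₂ (refl , b≤k+r)

emptyShape : ∀ m → LexShape 1 m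
emptyShape m = record { k = 0 ; r = 0 ; k+r<n = s≤s z≤n ; prefix⇒ = prefix⇒ ; prefix⇐ = prefix⇐ }
  where
  prefix⇒ : ∀ {u v} → (u , v) ∈ₗ take m (pairsLex 1) → LexPrefix 0 0 (toℕ u) (toℕ v)
  prefix⇒ p with subst (_ ∈ₗ_) (take-all m [] z≤n) p
  ... | ()
  prefix⇐ : ∀ {u v} → LexPrefix 0 0 (toℕ u) (toℕ v) → (u , v) ∈ₗ take m (pairsLex 1)
  prefix⇐ {zero} {zero} (() , _)

firstRowShape : ∀ {n m} → m ≤ n → LexShape (suc n) m
firstRowShape {n} {m} m≤n = record { k = 0 ; r = m ; k+r<n = s≤s m≤n ; prefix⇒ = prefix⇒ ; prefix⇐ = prefix⇐ }
  where
  prefix≡ : take m (pairsLex (suc n)) ≡ map (λ j → zero , suc j) (take m (allFin n))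
  prefix≡ = begin
    take m (pairsLex (suc n))
      ≡⟨ cong (take m) (pairsLex-suc n) ⟩
    take m (firstRow n ++ map shift (pairsLex n))
      ≡⟨ take-++ˡ m (firstRow n) _ (subst (m ≤_) (sym (length-firstRow n)) m≤n) ⟩
    take m (firstRow n)
      ≡⟨ take-map m (allFin n) ⟩
    map (λ j → zero , suc j) (take m (allFin n)) ∎
    where open ≡-Reasoning
  prefix⇒ : ∀ {u v} → (u , v) ∈ₗ take m (pairsLex (suc n)) → LexPrefix 0 m (toℕ u) (toℕ v)
  prefix⇒ p with ∈-map⁻ _ (subst (_ ∈ₗ_) prefix≡ p)
  ... | j , j∈ , refl = s≤s z≤n , inj₂ (refl , ∈-take-allFin⁻ j∈)
  prefix⇐ : ∀ {u v} → LexPrefix 0 m (toℕ u) (toℕ v) → (u , v) ∈ₗ take m (pairsLex (suc n))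
  prefix⇐ {zero}  {zero}  (() , _)
  prefix⇐ {zero}  {suc j} (_ , inj₂ (_ , j<m)) = subst (_ ∈ₗ_) (sym prefix≡) (∈-map⁺ _ (∈-take-allFin⁺ j<m))
  prefix⇐ {suc _} {_}     (_ , inj₂ (() , _))

shiftShape : ∀ {n m} → n ≤ m → LexShape n (m ∸ n) → LexShape (suc n) m
shiftShape {n} {m} n≤m shape = record
  { k = suc k ; r = r ; k+r<n = s≤s k+r<n ; prefix⇒ = prefix⇒ ; prefix⇐ = prefix⇐ }
  where
  open LexShape shape renaming (prefix⇒ to prefix⇒ₙ; prefix⇐ to prefix⇐ₙ)
  prefix≡ : take m (pairsLex (suc n)) ≡ firstRow n ++ map shift (take (m ∸ n) (pairsLex n))
  prefix≡ = begin
    take m (pairsLex (suc n))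
      ≡⟨ cong (take m) (pairsLex-suc n) ⟩
    take m (firstRow n ++ map shift (pairsLex n))
      ≡⟨ take-++ʳ m (firstRow n) _ (subst (_≤ m) (sym (length-firstRow n)) n≤m) ⟩
    firstRow n ++ take (m ∸ length (firstRow n)) (map shift (pairsLex n))
      ≡⟨ cong (λ l → firstRow n ++ take (m ∸ l) (map shift (pairsLex n))) (length-firstRow n) ⟩
    firstRow n ++ take (m ∸ n) (map shift (pairsLex n))
      ≡⟨ cong (firstRow n ++_) (take-map (m ∸ n) (pairsLex n)) ⟩
    firstRow n ++ map shift (take (m ∸ n) (pairsLex n)) ∎
    where open ≡-Reasoning
  prefix⇒ : ∀ {u v} → (u , v) ∈ₗ take m (pairsLex (suc n)) → LexPrefix (suc k) r (toℕ u) (toℕ v)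
  prefix⇒ p with ∈-++⁻ (firstRow n) (subst (_ ∈ₗ_) prefix≡ p)
  ... | inj₁ q with ∈-map⁻ _ q
  ...   | _ , _ , refl = s≤s z≤n , inj₁ (s≤s z≤n)
  prefix⇒ p | inj₂ q with ∈-map⁻ shift q
  ...   | _ , uv∈ , refl = prefix-suc⁺ (prefix⇒ₙ uv∈)
  prefix⇐ : ∀ {u v} → LexPrefix (suc k) r (toℕ u) (toℕ v) → (u , v) ∈ₗ take m (pairsLex (suc n))
  prefix⇐ {zero}  {zero}  (() , _)
  prefix⇐ {suc _} {zero}  (() , _)
  prefix⇐ {zero}  {suc j} _ = subst (_ ∈ₗ_) (sym prefix≡) (∈-++⁺ˡ (∈-map⁺ _ (∈-allFin j)))
  prefix⇐ {suc _} {suc _} s =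
    subst (_ ∈ₗ_) (sym prefix≡) (∈-++⁺ʳ (firstRow n) (∈-map⁺ shift (prefix⇐ₙ (prefix-suc⁻ s))))

lexShape : ∀ n m → LexShape (suc n) m
lexShape zero    m = emptyShape m
lexShape (suc n) m with m ≤? suc n
... | yes m≤n = firstRowShape m≤n
... | no  m≰n = shiftShape (<⇒≤ (≰⇒> m≰n)) (lexShape n (m ∸ suc n))

toSubset : ∀ {n p} {P : Pred (Fin n) p} → Decidable P → Subset n
toSubset P? = tabulate (does ∘ P?)

∈-toSubset⁺ : ∀ {n p} {P : Pred (Fin n) p} (P? : Decidable P) {x} → P x → x ∈ toSubset P?
∈-toSubset⁺ P? {x} px = lookup⇒[]= x _ (trans (lookup∘tabulate _ x) (dec-true (P? x) px))

∈-toSubset⁻ : ∀ {n p} {P : Pred (Fin n) p} (P? : Decidable P) {x} → x ∈ toSubset P? → P x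
∈-toSubset⁻ P? {x} x∈ with P? x | trans (sym (lookup∘tabulate (does ∘ P?) x)) ([]=⇒lookup x∈)
... | yes px | _ = px
... | no  _  | ()

∈-swapIn⁻ : ∀ {n} {A : Subset n} {u w x} → x ∈ swapIn A u w → x ≡ w ⊎ (x ≢ u × x ∈ A)
∈-swapIn⁻ {A = A} {u} {w} {x} x∈ with x ≟ w | x ≟ u | trans (sym (lookup∘tabulate _ x)) ([]=⇒lookup x∈)
... | yes x≡w | _       | _   = inj₁ x≡w
... | no  _   | yes _   | ()
... | no  _   | no  x≢u | x∈A = inj₂ (x≢u , lookup⇒[]= x A x∈A)

swapIn-⁅⁆ : ∀ {n} {i w : Fin n} → swapIn ⁅ i ⁆ i w ⊆ ⁅ w ⁆
swapIn-⁅⁆ {i = i} {w} x∈ with ∈-swapIn⁻ x∈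
... | inj₁ refl            = x∈⁅x⁆ w
... | inj₂ (x≢i , x∈⁅i⁆) = ⊥-elim (x≢i (x∈⁅y⁆⇒x≡y i x∈⁅i⁆))

nonempty⇒minimum : ∀ {n} {Z : Subset n} {z} → z ∈ Z → ∃[ i ] (i ∈ Z × (∀ y → y ∈ Z → toℕ i ≤ toℕ y))
nonempty⇒minimum {Z = inside  ∷ _} _ = zero , here , λ _ _ → z≤n
nonempty⇒minimum {Z = outside ∷ _} (there z∈Z) with nonempty⇒minimum z∈Z
... | i , i∈Z , i≤ = suc i , there i∈Z , λ { (suc y) (there y∈Z) → s≤s (i≤ y y∈Z) }

module _ {n m : ℕ} where
  open LexGraph n m

  independent-antimono : ∀ {A B} → A ⊆ B → Independent B → Independent A
  independent-antimono A⊆B indB u v u∈A v∈A = indB u v (A⊆B u∈A) (A⊆B v∈A)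

  maximal-⊆⇒≡ : ∀ {A B} → MaximalIndependent A → Independent B → A ⊆ B → A ≡ B
  maximal-⊆⇒≡ {A} {B} (_ , maximal) indB A⊆B = ⊆-antisym A⊆B B⊆A
    where
    B⊆A : B ⊆ A
    B⊆A {x} x∈B with x ∈? A
    ... | yes x∈A = x∈A
    ... | no  x∉A with maximal x x∉A
    ...   | a , a∈A , e = ⊥-elim (indB x a x∈B (A⊆B a∈A) e)

  active-if-neighbours-below : ∀ {A x} → x ∈ A → (∀ {w} → E x w → toℕ w < toℕ x) → Int A x
  active-if-neighbours-below x∈A below = x∈A , λ w (e , _) → below e

  inactive-if-larger-substitute : ∀ {A x w} → E x w → Independent (swapIn A x w) → toℕ x < toℕ w → ¬ Int A x
  inactive-if-larger-substitute e ind x<w (_ , subs<) = <-asym x<w (subs< _ (e , ind))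

  InInterval-bounded-below : ∀ {A Z z} → InInterval A Z → z ∈ Z → ∃[ a ] (a ∈ A × toℕ a ≤ toℕ z)
  InInterval-bounded-below {z = z} (_ , upper) z∈Z with upper z z∈Z
  ... | inj₁ z∈A                     = z , z∈A , ≤-refl
  ... | inj₂ (_ , a , a∈A , _ , a<z) = a , a∈A , <⇒≤ a<z

-- Maximal independent sets of L(n, m) and their intervals

module LexGraphPartition {n m : ℕ} (shape : LexShape n m) where
  open LexShape shape
  open LexGraph n m

  Adj : ℕ → ℕ → Set
  Adj a b = LexPrefix k r a b ⊎ LexPrefix k r b a

  edge⇒adj : ∀ {u v} → E u v → Adj (toℕ u) (toℕ v)
  edge⇒adj = Sum.map prefix⇒ prefix⇒

  adj⇒edge : ∀ {u v a b} → toℕ u ≡ a → toℕ v ≡ b → Adj a b → E u v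
  adj⇒edge refl refl = Sum.map prefix⇐ prefix⇐

  adj-sym : ∀ {a b} → Adj a b → Adj b a
  adj-sym = Sum.swap

  adj-irrefl : ∀ {a} → ¬ Adj a a
  adj-irrefl (inj₁ (a<a , _)) = <-irrefl refl a<a
  adj-irrefl (inj₂ (a<a , _)) = <-irrefl refl a<a

  adj-universal : ∀ {a b} → a < k → a ≢ b → Adj a b
  adj-universal {a} {b} a<k a≢b with <-cmp a b
  ... | tri< a<b _ _ = inj₁ (a<b , inj₁ a<k)
  ... | tri≈ _ a≡b _ = ⊥-elim (a≢b a≡b)
  ... | tri> _ _ b<a = inj₂ (b<a , inj₁ (<-trans b<a a<k))

  adj-pivot : ∀ {b} → k < b → b ≤ k + r → Adj k b
  adj-pivot k<b b≤k+r = inj₁ (k<b , inj₂ (refl , b≤k+r))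

  adj-pivot⁻ : ∀ {b} → k < b → Adj k b → b ≤ k + r
  adj-pivot⁻ k<b (inj₁ (_ , inj₁ k<k))         = ⊥-elim (<-irrefl refl k<k)
  adj-pivot⁻ k<b (inj₁ (_ , inj₂ (_ , b≤k+r))) = b≤k+r
  adj-pivot⁻ k<b (inj₂ (b<k , _))              = ⊥-elim (<-asym k<b b<k)

  adj-above : ∀ {a b} → k < a → Adj a b → b ≤ k
  adj-above k<a (inj₁ (_ , inj₁ a<k))        = ⊥-elim (<-asym k<a a<k)
  adj-above k<a (inj₁ (_ , inj₂ (refl , _))) = ⊥-elim (<-irrefl refl k<a)
  adj-above k<a (inj₂ (_ , inj₁ b<k))        = <⇒≤ b<k
  adj-above k<a (inj₂ (_ , inj₂ (refl , _))) = ≤-refl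

  adj-beyond : ∀ {a b} → k + r < a → Adj a b → b < k
  adj-beyond k+r<a (inj₂ (_ , inj₁ b<k))          = b<k
  adj-beyond k+r<a (inj₂ (_ , inj₂ (_ , a≤k+r))) = ⊥-elim (<⇒≱ k+r<a a≤k+r)
  adj-beyond k+r<a (inj₁ (_ , inj₁ a<k))          = ⊥-elim (<-asym a<k (≤-<-trans (m≤m+n k r) k+r<a))
  adj-beyond k+r<a (inj₁ (_ , inj₂ (refl , _)))   = ⊥-elim (<-irrefl refl (≤-<-trans (m≤m+n k r) k+r<a))

  k<n : k < n
  k<n = ≤-<-trans (m≤m+n k r) k+r<n

  pivot : Fin n
  pivot = fromℕ< k<n

  toℕ-pivot : toℕ pivot ≡ k
  toℕ-pivot = toℕ-fromℕ< k<n

  ≡pivot : ∀ {x} → toℕ x ≡ k → x ≡ pivot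
  ≡pivot x≡k = toℕ-injective (trans x≡k (sym toℕ-pivot))

  lastNeighbour : Fin n
  lastNeighbour = fromℕ< k+r<n

  nextAbove : 0 < r → Fin n
  nextAbove 0<r = fromℕ< (≤-<-trans (m<m+n k 0<r) k+r<n)

  above? : Decidable (λ (x : Fin n) → k < toℕ x)
  above? x = k ℕ.<? toℕ x

  pivotOrFar? : Decidable (λ (x : Fin n) → toℕ x ≡ k ⊎ k + r < toℕ x)
  pivotOrFar? x = (toℕ x ℕ.≟ k) ⊎-dec (k + r ℕ.<? toℕ x)

  abovePivot : Subset n
  abovePivot = toSubset above?

  pivotAndFar : Subset n
  pivotAndFar = toSubset pivotOrFar?

  ∈-abovePivot⁺ : ∀ {x} → k < toℕ x → x ∈ abovePivot
  ∈-abovePivot⁺ = ∈-toSubset⁺ above?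

  ∈-abovePivot⁻ : ∀ {x} → x ∈ abovePivot → k < toℕ x
  ∈-abovePivot⁻ = ∈-toSubset⁻ above?

  ∈-pivotAndFar⁺ : ∀ {x} → toℕ x ≡ k ⊎ k + r < toℕ x → x ∈ pivotAndFar
  ∈-pivotAndFar⁺ = ∈-toSubset⁺ pivotOrFar?

  ∈-pivotAndFar⁻ : ∀ {x} → x ∈ pivotAndFar → toℕ x ≡ k ⊎ k + r < toℕ x
  ∈-pivotAndFar⁻ = ∈-toSubset⁻ pivotOrFar?

  pivot∈pivotAndFar : pivot ∈ pivotAndFar
  pivot∈pivotAndFar = ∈-pivotAndFar⁺ (inj₁ toℕ-pivot)

  pivotAndFar-≥ : ∀ {x} → x ∈ pivotAndFar → k ≤ toℕ x
  pivotAndFar-≥ x∈ with ∈-pivotAndFar⁻ x∈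
  ... | inj₁ x≡k   = ≤-reflexive (sym x≡k)
  ... | inj₂ k+r<x = ≤-trans (m≤m+n k r) (<⇒≤ k+r<x)

  ⁅⁆-independent : ∀ i → Independent ⁅ i ⁆
  ⁅⁆-independent i u v u∈ v∈ e with x∈⁅y⁆⇒x≡y i u∈ | x∈⁅y⁆⇒x≡y i v∈
  ... | refl | refl = adj-irrefl (edge⇒adj e)

  abovePivot-independent : Independent abovePivot
  abovePivot-independent u v u∈ v∈ e =
    <⇒≱ (∈-abovePivot⁻ v∈) (adj-above (∈-abovePivot⁻ u∈) (edge⇒adj e))

  pivotAndFar-independent : Independent pivotAndFar
  pivotAndFar-independent u v u∈ v∈ e with ∈-pivotAndFar⁻ u∈ | ∈-pivotAndFar⁻ v∈
  ... | _         | inj₂ v-far = <⇒≱ (adj-beyond v-far (adj-sym (edge⇒adj e))) (pivotAndFar-≥ u∈)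
  ... | inj₂ u-far | _         = <⇒≱ (adj-beyond u-far (edge⇒adj e)) (pivotAndFar-≥ v∈)
  ... | inj₁ u≡k  | inj₁ v≡k   = adj-irrefl (subst (Adj (toℕ u)) (trans v≡k (sym u≡k)) (edge⇒adj e))

  ⁅⁆-inactive : ∀ {i} → toℕ i < k → ¬ Int ⁅ i ⁆ i
  ⁅⁆-inactive {i} i<k = inactive-if-larger-substitute
    (adj⇒edge refl toℕ-pivot (adj-universal i<k (<⇒≢ i<k)))
    (independent-antimono swapIn-⁅⁆ (⁅⁆-independent pivot))
    (subst (toℕ i <_) (sym toℕ-pivot) i<k)

  pivot-inactive : 0 < r → ¬ Int pivotAndFar pivot
  pivot-inactive 0<r = inactive-if-larger-substitute
    (adj⇒edge toℕ-pivot toℕ-lastNeighbour (adj-pivot k<k+r ≤-refl))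
    (independent-antimono swapped⊆abovePivot abovePivot-independent)
    (subst₂ _<_ (sym toℕ-pivot) (sym toℕ-lastNeighbour) k<k+r)
    where
    k<k+r : k < k + r
    k<k+r = m<m+n k 0<r
    toℕ-lastNeighbour : toℕ lastNeighbour ≡ k + r
    toℕ-lastNeighbour = toℕ-fromℕ< k+r<n
    swapped⊆abovePivot : swapIn pivotAndFar pivot lastNeighbour ⊆ abovePivot
    swapped⊆abovePivot x∈ with ∈-swapIn⁻ x∈
    ... | inj₁ refl             = ∈-abovePivot⁺ (subst (k <_) (sym toℕ-lastNeighbour) k<k+r)
    ... | inj₂ (x≢pivot , x∈′) with ∈-pivotAndFar⁻ x∈′
    ...   | inj₁ x≡k   = ⊥-elim (x≢pivot (≡pivot x≡k))
    ...   | inj₂ k+r<x = ∈-abovePivot⁺ (≤-<-trans (m≤m+n k r) k+r<x)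

  pivotAndFar-inactive : ∀ {x} → x ∈ pivotAndFar → ¬ Int pivotAndFar x → 0 < r × x ≡ pivot
  pivotAndFar-inactive {x} x∈ ¬active with ∈-pivotAndFar⁻ x∈
  ... | inj₂ k+r<x = ⊥-elim (¬active (active-if-neighbours-below x∈ λ e →
                       <-trans (adj-beyond k+r<x (edge⇒adj e)) (≤-<-trans (m≤m+n k r) k+r<x)))
  ... | inj₁ x≡k with r ℕ.≟ 0
  ...   | no r≢0  = n≢0⇒n>0 r≢0 , ≡pivot x≡k
  ...   | yes r≡0 = ⊥-elim (¬active (active-if-neighbours-below x∈ λ {w} e →
                       pivot-neighbour-below r≡0 (subst (λ a → Adj a (toℕ w)) x≡k (edge⇒adj e))))
    where
    pivot-neighbour-below : ∀ {b} → r ≡ 0 → Adj k b → b < toℕ x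
    pivot-neighbour-below {b} r≡0 adj with <-cmp b k
    ... | tri< b<k _ _ = subst (b <_) (sym x≡k) b<k
    ... | tri≈ _ b≡k _ = ⊥-elim (adj-irrefl (subst (Adj k) b≡k adj))
    ... | tri> _ _ k<b = ⊥-elim (<⇒≱ k<b (subst (b ≤_) (trans (cong (k +_) r≡0) (+-identityʳ k)) (adj-pivot⁻ k<b adj)))

  abovePivot-active : ∀ {x} → x ∈ abovePivot → Int abovePivot x
  abovePivot-active x∈ = active-if-neighbours-below x∈ λ e →
    ≤-<-trans (adj-above (∈-abovePivot⁻ x∈) (edge⇒adj e)) (∈-abovePivot⁻ x∈)

  data Kind : Subset n → Set where
    isSingleton   : ∀ i → toℕ i < k → Kind ⁅ i ⁆
    isPivotAndFar : Kind pivotAndFar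
    isAbovePivot  : 0 < r → Kind abovePivot

  kind⇒maximal : ∀ {A} → Kind A → MaximalIndependent A
  kind⇒maximal (isSingleton i i<k) = ⁅⁆-independent i , λ u u∉ →
    i , x∈⁅x⁆ i , adj⇒edge refl refl (adj-sym (adj-universal i<k (u∉ ∘ i≡⇒∈⁅i⁆ ∘ toℕ-injective)))
    where
    i≡⇒∈⁅i⁆ : ∀ {x} → i ≡ x → x ∈ ⁅ i ⁆
    i≡⇒∈⁅i⁆ i≡x = subst (_∈ ⁅ i ⁆) i≡x (x∈⁅x⁆ i)
  kind⇒maximal isPivotAndFar = pivotAndFar-independent , λ u u∉ → pivot , pivot∈pivotAndFar , toPivot u u∉
    where
    toPivot : ∀ u → u ∉ pivotAndFar → E u pivot
    toPivot u u∉ with <-cmp (toℕ u) k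
    ... | tri< u<k _ _ = adj⇒edge refl toℕ-pivot (adj-universal u<k (<⇒≢ u<k))
    ... | tri≈ _ u≡k _ = ⊥-elim (u∉ (∈-pivotAndFar⁺ (inj₁ u≡k)))
    ... | tri> _ _ k<u = adj⇒edge refl toℕ-pivot (adj-sym (adj-pivot k<u (≮⇒≥ (u∉ ∘ ∈-pivotAndFar⁺ ∘ inj₂))))
  kind⇒maximal (isAbovePivot 0<r) = abovePivot-independent , λ u u∉ →
    nextAbove 0<r , ∈-abovePivot⁺ (subst (k <_) (sym toℕ-next) ≤-refl) ,
    adj⇒edge refl toℕ-next (toNext (≮⇒≥ (u∉ ∘ ∈-abovePivot⁺)))
    where
    toℕ-next : toℕ (nextAbove 0<r) ≡ suc k
    toℕ-next = toℕ-fromℕ< (≤-<-trans (m<m+n k 0<r) k+r<n)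
    toNext : ∀ {a} → a ≤ k → Adj a (suc k)
    toNext a≤k with m≤n⇒m<n∨m≡n a≤k
    ... | inj₁ a<k = adj-universal a<k (<⇒≢ (s≤s a≤k))
    ... | inj₂ a≡k = subst (λ b → Adj b (suc k)) (sym a≡k) (adj-pivot ≤-refl (m<m+n k 0<r))

  ∄below⇒≥ : ∀ {A : Subset n} → ¬ (∃[ i ] (i ∈ A × toℕ i < k)) → ∀ x → x ∈ A → k ≤ toℕ x
  ∄below⇒≥ ∄i<k _ x∈A = ≮⇒≥ λ x<k → ∄i<k (_ , x∈A , x<k)

  maximal⇒kind : ∀ {A} → MaximalIndependent A → Kind A
  maximal⇒kind {A} maxA@(indA , maximal) with any? (λ i → (i ∈? A) ×-dec (toℕ i ℕ.<? k))
  ... | yes (i , i∈A , i<k) =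
    subst Kind (maximal-⊆⇒≡ (kind⇒maximal (isSingleton i i<k)) indA ⁅i⁆⊆A) (isSingleton i i<k)
    where
    ⁅i⁆⊆A : ⁅ i ⁆ ⊆ A
    ⁅i⁆⊆A x∈ = subst (_∈ A) (sym (x∈⁅y⁆⇒x≡y i x∈)) i∈A
  ... | no ∄i<k with pivot ∈? A
  ...   | yes pivot∈A = subst Kind (sym (maximal-⊆⇒≡ maxA pivotAndFar-independent A⊆)) isPivotAndFar
    where
    A⊆ : A ⊆ pivotAndFar
    A⊆ {x} x∈A with toℕ x ℕ.≟ k
    ... | yes x≡k = ∈-pivotAndFar⁺ (inj₁ x≡k)
    ... | no  x≢k = ∈-pivotAndFar⁺ (inj₂ (≰⇒> λ x≤k+r → indA pivot x pivot∈A x∈A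
                      (adj⇒edge toℕ-pivot refl (adj-pivot (≤∧≢⇒< (∄below⇒≥ ∄i<k _ x∈A) (x≢k ∘ sym)) x≤k+r))))
  ...   | no pivot∉A = subst Kind (sym (maximal-⊆⇒≡ maxA abovePivot-independent A⊆)) (isAbovePivot 0<r)
    where
    above : ∀ {x} → x ∈ A → k < toℕ x
    above x∈A = ≤∧≢⇒< (∄below⇒≥ ∄i<k _ x∈A) λ k≡x → pivot∉A (subst (_∈ A) (≡pivot (sym k≡x)) x∈A)
    A⊆ : A ⊆ abovePivot
    A⊆ x∈A = ∈-abovePivot⁺ (above x∈A)
    0<r : 0 < r
    0<r with maximal pivot pivot∉A
    ... | a , a∈A , e = +-cancelˡ-< k 0 r (subst (_< k + r) (sym (+-identityʳ k))
            (<-≤-trans (above a∈A) (adj-pivot⁻ (above a∈A) (subst (λ b → Adj b (toℕ a)) toℕ-pivot (edge⇒adj e)))))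

  Fits : ∀ {A} → Kind A → Subset n → Set
  Fits (isSingleton i _) Z = i ∈ Z × (∀ z → z ∈ Z → toℕ i ≤ toℕ z)
  Fits isPivotAndFar     Z = (∀ z → z ∈ Z → k ≤ toℕ z) × (0 < r → pivot ∈ Z)
  Fits (isAbovePivot _)  Z = ∀ z → z ∈ Z → k < toℕ z

  fits⇒InInterval : ∀ {A Z} (κ : Kind A) → Fits κ Z → InInterval A Z
  fits⇒InInterval {Z = Z} (isSingleton i i<k) (i∈Z , i≤) = lower , upper
    where
    lower : ∀ x → x ∈ ⁅ i ⁆ → ¬ Int ⁅ i ⁆ x → x ∈ Z
    lower x x∈ _ = subst (_∈ Z) (sym (x∈⁅y⁆⇒x≡y i x∈)) i∈Z
    upper : ∀ z → z ∈ Z → z ∈ ⁅ i ⁆ ⊎ Ext ⁅ i ⁆ z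
    upper z z∈Z with z ≟ i
    ... | yes refl = inj₁ (x∈⁅x⁆ i)
    ... | no  z≢i  = inj₂ (z≢i ∘ x∈⁅y⁆⇒x≡y i , i , x∈⁅x⁆ i ,
                           adj⇒edge refl refl (adj-universal i<k i≢z) , ≤∧≢⇒< (i≤ z z∈Z) i≢z)
      where
      i≢z : toℕ i ≢ toℕ z
      i≢z = z≢i ∘ sym ∘ toℕ-injective
  fits⇒InInterval {Z = Z} isPivotAndFar (k≤ , pivot∈Z) = lower , upper
    where
    lower : ∀ x → x ∈ pivotAndFar → ¬ Int pivotAndFar x → x ∈ Z
    lower x x∈ ¬active with pivotAndFar-inactive x∈ ¬active
    ... | 0<r , refl = pivot∈Z 0<r
    upper : ∀ z → z ∈ Z → z ∈ pivotAndFar ⊎ Ext pivotAndFar z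
    upper z z∈Z with z ∈? pivotAndFar
    ... | yes z∈ = inj₁ z∈
    ... | no  z∉ = inj₂ (z∉ , pivot , pivot∈pivotAndFar ,
                         adj⇒edge toℕ-pivot refl (adj-pivot k<z (≮⇒≥ (z∉ ∘ ∈-pivotAndFar⁺ ∘ inj₂))) ,
                         subst (_< toℕ z) (sym toℕ-pivot) k<z)
      where
      k<z : k < toℕ z
      k<z = ≤∧≢⇒< (k≤ z z∈Z) (z∉ ∘ ∈-pivotAndFar⁺ ∘ inj₁ ∘ sym)
  fits⇒InInterval (isAbovePivot _) above =
    (λ x x∈ ¬active → ⊥-elim (¬active (abovePivot-active x∈))) ,
    (λ z z∈Z → inj₁ (∈-abovePivot⁺ (above z z∈Z)))

  InInterval⇒fits : ∀ {A Z} (κ : Kind A) → InInterval A Z → Fits κ Z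
  InInterval⇒fits (isSingleton i i<k) I@(lower , _) = lower i (x∈⁅x⁆ i) (⁅⁆-inactive i<k) , λ z z∈Z →
    let a , a∈ , a≤z = InInterval-bounded-below I z∈Z in subst (λ b → toℕ b ≤ toℕ z) (x∈⁅y⁆⇒x≡y i a∈) a≤z
  InInterval⇒fits isPivotAndFar I@(lower , _) = (λ z z∈Z →
    let a , a∈ , a≤z = InInterval-bounded-below I z∈Z in ≤-trans (pivotAndFar-≥ a∈) a≤z) ,
    λ 0<r → lower pivot pivot∈pivotAndFar (pivot-inactive 0<r)
  InInterval⇒fits (isAbovePivot _) I z z∈Z =
    let a , a∈ , a≤z = InInterval-bounded-below I z∈Z in <-≤-trans (∈-abovePivot⁻ a∈) a≤z

  fits-unique : ∀ {A B Z} (κ : Kind A) (κ′ : Kind B) → Fits κ Z → Fits κ′ Z → A ≡ B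
  fits-unique (isSingleton i _) (isSingleton j _) (i∈Z , i≤) (j∈Z , j≤) =
    cong ⁅_⁆ (toℕ-injective (≤-antisym (i≤ j j∈Z) (j≤ i i∈Z)))
  fits-unique (isSingleton i i<k) isPivotAndFar    (i∈Z , _) (k≤ , _) = ⊥-elim (<⇒≱ i<k (k≤ i i∈Z))
  fits-unique (isSingleton i i<k) (isAbovePivot _) (i∈Z , _) above    = ⊥-elim (<-asym i<k (above i i∈Z))
  fits-unique isPivotAndFar    (isSingleton i i<k) (k≤ , _) (i∈Z , _) = ⊥-elim (<⇒≱ i<k (k≤ i i∈Z))
  fits-unique (isAbovePivot _) (isSingleton i i<k) above    (i∈Z , _) = ⊥-elim (<-asym i<k (above i i∈Z))
  fits-unique isPivotAndFar    isPivotAndFar    _ _ = refl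
  fits-unique (isAbovePivot _) (isAbovePivot _) _ _ = refl
  fits-unique isPivotAndFar (isAbovePivot 0<r) (_ , pivot∈Z) above =
    ⊥-elim (<-irrefl (sym toℕ-pivot) (above pivot (pivot∈Z 0<r)))
  fits-unique (isAbovePivot 0<r) isPivotAndFar above (_ , pivot∈Z) =
    ⊥-elim (<-irrefl (sym toℕ-pivot) (above pivot (pivot∈Z 0<r)))

  fits-exists : ∀ Z → ∃[ A ] Σ[ κ ∈ Kind A ] Fits κ Z
  fits-exists Z with any? (λ z → (z ∈? Z) ×-dec (toℕ z ℕ.<? k))
  ... | yes (z , z∈Z , z<k) =
    let i , i∈Z , i≤ = nonempty⇒minimum z∈Z in ⁅ i ⁆ , isSingleton i (≤-<-trans (i≤ z z∈Z) z<k) , i∈Z , i≤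
  ... | no ∄z<k with pivot ∈? Z | r ℕ.≟ 0
  ...   | yes pivot∈Z | _       = pivotAndFar , isPivotAndFar , ∄below⇒≥ ∄z<k , λ _ → pivot∈Z
  ...   | no  _       | yes r≡0 = pivotAndFar , isPivotAndFar , ∄below⇒≥ ∄z<k , λ 0<r → ⊥-elim (<-irrefl (sym r≡0) 0<r)
  ...   | no  pivot∉Z | no  r≢0 = abovePivot , isAbovePivot (n≢0⇒n>0 r≢0) , λ z z∈Z →
    ≤∧≢⇒< (∄below⇒≥ ∄z<k z z∈Z) λ k≡z → pivot∉Z (subst (_∈ Z) (≡pivot (sym k≡z)) z∈Z)

  partition : (∀ Z → ∃[ A ] (MaximalIndependent A × InInterval A Z))
            × (∀ Z A B → MaximalIndependent A → MaximalIndependent B →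
               InInterval A Z → InInterval B Z → A ≡ B)
  partition = existence , uniqueness
    where
    existence : ∀ Z → ∃[ A ] (MaximalIndependent A × InInterval A Z)
    existence Z = let A , κ , fits = fits-exists Z in A , kind⇒maximal κ , fits⇒InInterval κ fits
    uniqueness : ∀ Z A B → MaximalIndependent A → MaximalIndependent B →
                 InInterval A Z → InInterval B Z → A ≡ B
    uniqueness Z A B maxA maxB Z∈[A] Z∈[B] = fits-unique (maximal⇒kind maxA) (maximal⇒kind maxB)
      (InInterval⇒fits (maximal⇒kind maxA) Z∈[A]) (InInterval⇒fits (maximal⇒kind maxB) Z∈[B])

theorem11 : (n m : ℕ) → n ≥ 1 → m ≤ n C 2 →
    let open LexGraph n m in
    (∀ (Z : Subset n) → ∃[ A ] (MaximalIndependent A × InInterval A Z))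
    × (∀ (Z A B : Subset n) → MaximalIndependent A → MaximalIndependent B →
         InInterval A Z → InInterval B Z → A ≡ B)
theorem11 zero    m ()  _
theorem11 (suc n) m _   _ = LexGraphPartition.partition (lexShape n m)
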